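{- Let $\psi$ be a sentence of the form $\exists x_1\cdots\exists x_m\ \ s_1\le t_1\ \&\ \cdots\ \&\ s_k\le t_k\ \&\ u_1\not\le v_1\ \&\ \cdots\ \&\ u_\ell\not\le v_\ell$, where $s_i,t_i,u_j,v_j$ are lattice terms in $x_1,\dots,x_m$ each built from variables using only the join operation, and suppose $\psi$ is consistent, i.e. holds in some lattice. Then $\psi$ holds in some finite distributive lattice, and hence also in a free lattice. -}

module Defs where

open import Level using (Level; _⊔_; 0ℓ) renaming (suc to lsuc)
open import Data.Nat using (ℕ)
open import Data.Fin using (Fin)
open import Data.List using (List)
open import Data.List.Relation.Unary.All using (All)
open import Data.Product using (Σ; ∃; _×_; _,_)
open import Relation.Nullary using (¬_)
open import Algebra.Lattice.Bundles using (Lattice; DistributiveLattice)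
open import Algebra.Lattice.Morphism.Structures using (module LatticeMorphisms)

data JTerm (m : ℕ) : Set where
  var  : Fin m → JTerm m
  _⊔ₜ_ : JTerm m → JTerm m → JTerm m

record JSentence : Set where
  constructor mkSentence
  field
    nvars : ℕ
    leqs  : List (JTerm nvars × JTerm nvars)
    nleqs : List (JTerm nvars × JTerm nvars)

module _ {c ℓ : Level} (L : Lattice c ℓ) where
  open Lattice L

  _≤L_ : Carrier → Carrier → Set ℓ
  x ≤L y = (x ∨ y) ≈ y

  ⟦_⟧ : {m : ℕ} → JTerm m → (Fin m → Carrier) → Carrier
  ⟦ var i ⟧ ρ    = ρ i
  ⟦ s ⊔ₜ t ⟧ ρ   = ⟦ s ⟧ ρ ∨ ⟦ t ⟧ ρ

  Holds : JSentence → Set (c ⊔ ℓ)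
  Holds (mkSentence m ls ns) =
    Σ (Fin m → Carrier) λ ρ →
      All (λ p → ⟦ Data.Product.proj₁ p ⟧ ρ ≤L ⟦ Data.Product.proj₂ p ⟧ ρ) ls
      × All (λ p → ¬ (⟦ Data.Product.proj₁ p ⟧ ρ ≤L ⟦ Data.Product.proj₂ p ⟧ ρ)) ns

  Finite : Set (c ⊔ ℓ)
  Finite = Σ ℕ λ n → Σ (Fin n → Carrier) λ e → (x : Carrier) → ∃ λ i → e i ≈ x

IsFreeLatticeOn : (L : Lattice 0ℓ 0ℓ) {X : Set} → (X → Lattice.Carrier L) → Set₁
IsFreeLatticeOn L {X} g =
  (M : Lattice 0ℓ 0ℓ) (f : X → Lattice.Carrier M) →
  let open LatticeMorphisms (Lattice.rawLattice L) (Lattice.rawLattice M) in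
  Σ (Lattice.Carrier L → Lattice.Carrier M) λ h →
    IsLatticeHomomorphism h
    × ((x : X) → Lattice._≈_ M (h (g x)) (f x))
    × ((h' : Lattice.Carrier L → Lattice.Carrier M) → IsLatticeHomomorphism h' →
       ((x : X) → Lattice._≈_ M (h' (g x)) (f x)) →
       (y : Lattice.Carrier L) → Lattice._≈_ M (h' y) (h y))

IsFreeLattice : Lattice 0ℓ 0ℓ → Set₁
IsFreeLattice L = Σ Set λ X → Σ (X → Lattice.Carrier L) λ g → IsFreeLatticeOn L g

-- A negated atom u ≰ v of ψ is refuted by a two-valued model of the positive atoms: in a
-- lattice satisfying ψ under ρ, the map x ↦ [x ≰ ⟦v⟧ρ] into the two-element lattice preserves
-- joins, and join-terms use nothing but joins.  That map need not be computable, but its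
-- restriction to the variables exists up to double negation, and satisfiability in the
-- two-element lattice is decidable, so a finite search produces such a model.  The product of
-- these models over the k negated atoms is a model in the lattice of subsets of a k-element set.
-- Finally p ↦ g₀ ∨ ⋁ᵢ∈ₚ gᵢ₊₁ is a join-preserving order embedding of that lattice into the free
-- lattice on g₀, …, gₖ, since the homomorphism g₀ ↦ ∅, gᵢ₊₁ ↦ {i} is a left inverse of it.

module Submission where

open import Defs
open import Level using (Level; 0ℓ)
open import Function using (_∘_; _⇔_; mk⇔; Equivalence)
open import Function.Construct.Composition using (_⇔-∘_)
open import Function.Construct.Symmetry using (⇔-sym)
open import Data.Nat using (ℕ; zero; suc)
open import Data.Fin using (Fin; zero; suc)
open import Data.Fin.Properties using (∀-cons)
open import Data.Bool using (Bool; true; false; not) renaming (_∨_ to _∨ᴮ_)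
open import Data.Bool.Properties using (∨-zeroʳ; ∨-conicalˡ; ∨-conicalʳ; ∨-∧-lattice)
  renaming (_≟_ to _≟ᴮ_)
open import Data.Product using (Σ; _×_; _,_; proj₁; proj₂; ∃)
open import Data.Product.Function.NonDependent.Propositional using (_×-⇔_)
open import Data.List using (List; []; _∷_; length; lookup; cartesianProductWith)
open import Data.List.Relation.Unary.All as All using (All; []; _∷_; all?)
open import Data.List.Relation.Unary.Any using (here; there)
open import Data.List.Membership.Propositional using (_∈_)
open import Data.List.Membership.Propositional.Properties using (∈-cartesianProductWith⁺)
open import Data.List.Relation.Unary.Enumerates.Setoid using (IsEnumeration)
open import Data.List.Relation.Unary.Enumerates.Setoid.Properties using (lookup-surjective)
open import Data.Vec using ([]; _∷_; tabulate) renaming (lookup to vlookup)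
open import Data.Vec.Properties using (lookup∘tabulate; ∷-injective)
open import Data.Fin.Subset using (Subset; inside; outside; ⊥; ⁅_⁆; _∪_)
open import Data.Fin.Subset.Properties using (∪-∩-distributiveLattice; ∪-identityˡ; anySubset?)
open import Algebra.Lattice.Bundles using (Lattice; DistributiveLattice)
open import Algebra.Bundles using (CommutativeSemigroup)
import Algebra.Properties.CommutativeSemigroup as CommutativeSemigroupProperties
import Algebra.Lattice.Properties.Lattice as LatticeProperties
open import Algebra.Lattice.Morphism.Structures using (module LatticeMorphisms)
open import Relation.Binary.Lattice using (JoinSemilattice)
open import Relation.Nullary using (¬_; Dec; yes; no; does; ¬?; _×-dec_)
open import Relation.Nullary.Negation using (¬¬-map; contradiction)
open import Relation.Nullary.Decidable using (¬¬-excluded-middle; decidable-stable)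
open import Relation.Binary.PropositionalEquality as ≡ using (_≡_; refl; cong; cong₂)

open Equivalence using (to; from)

module _ {c ℓ : Level} (L : Lattice c ℓ) where
  open Lattice L using (Carrier; _≈_; setoid; ∨-cong; sym; trans)

  Satisfies : {m : ℕ} → (Fin m → Carrier) → (ls ns : List (JTerm m × JTerm m)) → Set ℓ
  Satisfies ρ ls ns =
    All (λ p → _≤L_ L (⟦_⟧ L (proj₁ p) ρ) (⟦_⟧ L (proj₂ p) ρ)) ls
    × All (λ p → ¬ (_≤L_ L (⟦_⟧ L (proj₁ p) ρ) (⟦_⟧ L (proj₂ p) ρ))) ns

  restrict-to-each-negation : ∀ {m} ls ns → Holds L (mkSentence m ls ns) →
                      All (λ n → Holds L (mkSentence m ls (n ∷ []))) ns
  restrict-to-each-negation ls ns (ρ , les , nles) = All.map (λ nle → ρ , les , nle ∷ []) nles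

  ≤L-resp-≈ : ∀ {x x′ y y′} → x ≈ x′ → y ≈ y′ → _≤L_ L x y → _≤L_ L x′ y′
  ≤L-resp-≈ x≈x′ y≈y′ x≤y = trans (∨-cong (sym x≈x′) (sym y≈y′)) (trans x≤y y≈y′)

  finite-of-enumeration : {xs : List Carrier} → IsEnumeration setoid xs → Finite L
  finite-of-enumeration {xs} enum =
    length xs , lookup xs , λ x → let i , i↦x = lookup-surjective setoid enum x in i , i↦x refl

module _ {a b ℓ₁ ℓ₂ : Level} (L : Lattice a ℓ₁) (M : Lattice b ℓ₂) where
  private
    module L = Lattice L
    module M = Lattice M

  ⟦⟧-preserves : ∀ {r} (R : L.Carrier → M.Carrier → Set r) →
                 (∀ {x y a b} → R x a → R y b → R (x L.∨ y) (a M.∨ b)) →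
                 ∀ {m} {ρ : Fin m → L.Carrier} {σ : Fin m → M.Carrier} →
                 (∀ i → R (ρ i) (σ i)) → ∀ t → R (⟦_⟧ L t ρ) (⟦_⟧ M t σ)
  ⟦⟧-preserves R R-∨ Rρσ (var i)  = Rρσ i
  ⟦⟧-preserves R R-∨ Rρσ (s ⊔ₜ t) = R-∨ (⟦⟧-preserves R R-∨ Rρσ s) (⟦⟧-preserves R R-∨ Rρσ t)

  module _ (f : L.Carrier → M.Carrier) (f-∨ : ∀ x y → f (x L.∨ y) M.≈ f x M.∨ f y) where

    ⟦⟧-homo : ∀ {m} (ρ : Fin m → L.Carrier) t → ⟦_⟧ M t (f ∘ ρ) M.≈ f (⟦_⟧ L t ρ)
    ⟦⟧-homo ρ = ⟦⟧-preserves (λ x y → y M.≈ f x)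
      (λ {x} {y} a≈fx b≈fy → M.trans (M.∨-cong a≈fx b≈fy) (M.sym (f-∨ x y))) (λ _ → M.refl)

    holds-along-join-embedding : (∀ {x y} → _≤L_ L x y ⇔ _≤L_ M (f x) (f y)) →
                            ∀ ψ → Holds L ψ → Holds M ψ
    holds-along-join-embedding ≤⇔ (mkSentence m ls ns) (ρ , les , nles) =
      f ∘ ρ , All.map (λ {p} → to (atom⇔ p)) les , All.map (λ {p} nle → nle ∘ from (atom⇔ p)) nles
      where
        atom⇔ : ∀ p → _≤L_ L (⟦_⟧ L (proj₁ p) ρ) (⟦_⟧ L (proj₂ p) ρ)
                    ⇔ _≤L_ M (⟦_⟧ M (proj₁ p) (f ∘ ρ)) (⟦_⟧ M (proj₂ p) (f ∘ ρ))
        atom⇔ (s , t) = mk⇔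
          (≤L-resp-≈ M (M.sym (⟦⟧-homo ρ s)) (M.sym (⟦⟧-homo ρ t)) ∘ to ≤⇔)
          (from ≤⇔ ∘ ≤L-resp-≈ M (⟦⟧-homo ρ s) (⟦⟧-homo ρ t))

𝔹 : Lattice 0ℓ 0ℓ
𝔹 = ∨-∧-lattice

≤𝔹⇔ : ∀ a b → _≤L_ 𝔹 a b ⇔ (b ≡ false → a ≡ false)
≤𝔹⇔ a b = mk⇔ (λ a∨b≡b b≡false → ∨-conicalˡ a b (≡.trans a∨b≡b b≡false)) (from′ a b)
  where
    from′ : ∀ a b → (b ≡ false → a ≡ false) → a ∨ᴮ b ≡ b
    from′ a true  _ = ∨-zeroʳ a
    from′ a false h rewrite h refl = refl

∨≡false⇔ : ∀ {a b} → a ∨ᴮ b ≡ false ⇔ (a ≡ false × b ≡ false)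
∨≡false⇔ {a} {b} = mk⇔ (λ e → ∨-conicalˡ a b e , ∨-conicalʳ a b e) λ { (refl , refl) → refl }

satisfies𝔹? : ∀ {m} (φ : Fin m → Bool) ls ns → Dec (Satisfies 𝔹 φ ls ns)
satisfies𝔹? φ ls ns = all? atom? ls ×-dec all? (¬? ∘ atom?) ns
  where
    atom? : ∀ p → Dec (_≤L_ 𝔹 (⟦_⟧ 𝔹 (proj₁ p) φ) (⟦_⟧ 𝔹 (proj₂ p) φ))
    atom? (s , t) = ⟦_⟧ 𝔹 s φ ∨ᴮ ⟦_⟧ 𝔹 t φ ≟ᴮ ⟦_⟧ 𝔹 t φ

¬¬-decide-all : ∀ {p} m (P : Fin m → Set p) → ¬ ¬ (∀ i → Dec (P i))
¬¬-decide-all zero    P ¬dec = ¬dec λ ()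
¬¬-decide-all (suc m) P ¬dec = ¬¬-excluded-middle λ dec₀ →
  ¬¬-decide-all m (P ∘ suc) λ decₛ → ¬dec (∀-cons dec₀ decₛ)

module _ {c ℓ : Level} (L : Lattice c ℓ) where
  open Lattice L using (Carrier; _∨_)
  open JoinSemilattice (LatticeProperties.∨-orderTheoreticJoinSemilattice L)
    using (_≤_; x≤x∨y; y≤x∨y; ∨-least) renaming (refl to ≤-refl; trans to ≤-trans)

  ≤L⇔≤ : ∀ {x y} → _≤L_ L x y ⇔ x ≤ y
  ≤L⇔≤ {x} {y} = mk⇔ (λ x∨y≈y → L.sym (L.trans (L.∨-comm y x) x∨y≈y))
                     (λ y≈y∨x → L.trans (L.∨-comm x y) (L.sym y≈y∨x))
    where module L = Lattice L

  ∨-≤⇔ : ∀ {x y w} → x ∨ y ≤ w ⇔ (x ≤ w × y ≤ w)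
  ∨-≤⇔ {x} {y} = mk⇔ (λ x∨y≤w → ≤-trans (x≤x∨y x y) x∨y≤w , ≤-trans (y≤x∨y x y) x∨y≤w)
                     λ (x≤w , y≤w) → ∨-least x≤w y≤w

  Indicates≰ : Carrier → Carrier → Bool → Set ℓ
  Indicates≰ w x b = x ≤ w ⇔ b ≡ false

  indicates≰-∨ : ∀ {w x y a b} → Indicates≰ w x a → Indicates≰ w y b →
                 Indicates≰ w (x ∨ y) (a ∨ᴮ b)
  indicates≰-∨ x↝a y↝b = ⇔-sym ∨≡false⇔ ⇔-∘ ((x↝a ×-⇔ y↝b) ⇔-∘ ∨-≤⇔)

  indicates≰-dec : ∀ {w x} (x≤w? : Dec (x ≤ w)) → Indicates≰ w x (not (does x≤w?))
  indicates≰-dec (yes x≤w) = mk⇔ (λ _ → refl) (λ _ → x≤w)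
  indicates≰-dec (no x≰w)  = mk⇔ (λ x≤w → contradiction x≤w x≰w) λ ()

  holds-in-𝔹 : ∀ {m} ls (n : JTerm m × JTerm m) →
               Holds L (mkSentence m ls (n ∷ [])) → Holds 𝔹 (mkSentence m ls (n ∷ []))
  holds-in-𝔹 {m} ls (u , v) (ρ , les , u≰v ∷ []) =
    let φ , sat = decidable-stable (anySubset? λ φ → satisfies𝔹? (vlookup φ) ls _)
                                   (¬¬-map separator (¬¬-decide-all m _))
    in vlookup φ , sat
    where
      ⟦_⟧ρ : JTerm m → Carrier
      ⟦ t ⟧ρ = ⟦_⟧ L t ρ

      separator : (∀ i → Dec (ρ i ≤ ⟦ v ⟧ρ)) → ∃ λ φ → Satisfies 𝔹 (vlookup φ) ls ((u , v) ∷ [])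
      separator ≤v? = φ , All.map (λ {p} → positive p) les , negative ∷ []
        where
          φ : Subset m
          φ = tabulate (λ i → not (does (≤v? i)))

          indicates : ∀ t → Indicates≰ ⟦ v ⟧ρ ⟦ t ⟧ρ (⟦_⟧ 𝔹 t (vlookup φ))
          indicates = ⟦⟧-preserves L 𝔹 (Indicates≰ ⟦ v ⟧ρ) indicates≰-∨ λ i →
            ≡.subst (Indicates≰ ⟦ v ⟧ρ (ρ i)) (≡.sym (lookup∘tabulate _ i)) (indicates≰-dec (≤v? i))

          positive : ∀ p → _≤L_ L ⟦ proj₁ p ⟧ρ ⟦ proj₂ p ⟧ρ →
                     _≤L_ 𝔹 (⟦_⟧ 𝔹 (proj₁ p) (vlookup φ)) (⟦_⟧ 𝔹 (proj₂ p) (vlookup φ))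
          positive (s , t) s≤t = from (≤𝔹⇔ _ _) λ t↦false →
            to (indicates s) (≤-trans (to ≤L⇔≤ s≤t) (from (indicates t) t↦false))

          negative : ¬ _≤L_ 𝔹 (⟦_⟧ 𝔹 u (vlookup φ)) (⟦_⟧ 𝔹 v (vlookup φ))
          negative u≤v =
            u≰v (from ≤L⇔≤ (from (indicates u) (to (≤𝔹⇔ _ _) u≤v (to (indicates v) ≤-refl))))


Subsets : ℕ → Lattice 0ℓ 0ℓ
Subsets k = DistributiveLattice.lattice (∪-∩-distributiveLattice k)

module _ {m : ℕ} (ls : List (JTerm m × JTerm m)) where

  holds-in-Subsets-∷ : ∀ {k n ns} →
    Holds 𝔹 (mkSentence m ls (n ∷ [])) → Holds (Subsets k) (mkSentence m ls ns) →
    Holds (Subsets (suc k)) (mkSentence m ls (n ∷ ns))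
  holds-in-Subsets-∷ {k} {n} (φ , les₀ , nle₀ ∷ []) (ρ , les , nles) =
    ρ′ , All.zipWith (λ {p} → from (atom⇔ p)) (les₀ , les)
       , (nle₀ ∘ proj₁ ∘ to (atom⇔ n)) ∷ All.map (λ {p} nle → nle ∘ proj₂ ∘ to (atom⇔ p)) nles
    where
      ρ′ : Fin m → Subset (suc k)
      ρ′ i = φ i ∷ ρ i

      ⟦⟧-∷ : ∀ t → ⟦_⟧ (Subsets (suc k)) t ρ′ ≡ ⟦_⟧ 𝔹 t φ ∷ ⟦_⟧ (Subsets k) t ρ
      ⟦⟧-∷ (var i)  = refl
      ⟦⟧-∷ (s ⊔ₜ t) = cong₂ _∪_ (⟦⟧-∷ s) (⟦⟧-∷ t)

      atom⇔ : ∀ p →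
        _≤L_ (Subsets (suc k)) (⟦_⟧ (Subsets (suc k)) (proj₁ p) ρ′) (⟦_⟧ (Subsets (suc k)) (proj₂ p) ρ′)
        ⇔ (_≤L_ 𝔹 (⟦_⟧ 𝔹 (proj₁ p) φ) (⟦_⟧ 𝔹 (proj₂ p) φ)
           × _≤L_ (Subsets k) (⟦_⟧ (Subsets k) (proj₁ p) ρ) (⟦_⟧ (Subsets k) (proj₂ p) ρ))
      atom⇔ (s , t) rewrite ⟦⟧-∷ s | ⟦⟧-∷ t = mk⇔ ∷-injective λ (e₀ , e) → cong₂ _∷_ e₀ e

  holds-in-Subsets : ∀ {ns} → All (λ n → Holds 𝔹 (mkSentence m ls (n ∷ []))) ns →
                     Holds (Subsets (length ns)) (mkSentence m ls ns)
  holds-in-Subsets []         = (λ _ → []) , All.universal (λ _ → Subset₀-unique _ _) ls , []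
    where
      Subset₀-unique : (p q : Subset 0) → p ≡ q
      Subset₀-unique [] [] = refl
  holds-in-Subsets (h ∷ hs) = holds-in-Subsets-∷ h (holds-in-Subsets hs)

allSubsets : ∀ k → List (Subset k)
allSubsets zero    = [] ∷ []
allSubsets (suc k) = cartesianProductWith _∷_ (inside ∷ outside ∷ []) (allSubsets k)

∈-allSubsets : ∀ {k} (p : Subset k) → p ∈ allSubsets k
∈-allSubsets []      = here refl
∈-allSubsets (x ∷ p) =
  ∈-cartesianProductWith⁺ _∷_ {xs = inside ∷ outside ∷ []} (∈-sides x) (∈-allSubsets p)
  where
    ∈-sides : ∀ x → x ∈ inside ∷ outside ∷ []
    ∈-sides inside  = here refl
    ∈-sides outside = there (here refl)

Subsets-finite : ∀ k → Finite (Subsets k)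
Subsets-finite k = finite-of-enumeration (Subsets k) ∈-allSubsets

module _ {c ℓ : Level} (M : Lattice c ℓ) where
  open Lattice M
  open LatticeProperties M using (∨-idem; ∨-isSemigroup)

  ∨-commutativeSemigroup : CommutativeSemigroup c ℓ
  ∨-commutativeSemigroup = record
    { isCommutativeSemigroup = record { isSemigroup = ∨-isSemigroup ; comm = ∨-comm } }

  open CommutativeSemigroupProperties ∨-commutativeSemigroup using (interchange; x∙yz≈y∙xz)

  infix 7 _∨⋁[_]_
  _∨⋁[_]_ : ∀ {k} → Carrier → Subset k → (Fin k → Carrier) → Carrier
  b ∨⋁[ [] ]          g = b
  b ∨⋁[ inside  ∷ p ] g = g zero ∨ (b ∨⋁[ p ] (g ∘ suc))
  b ∨⋁[ outside ∷ p ] g = b ∨⋁[ p ] (g ∘ suc)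

  ∨⋁-∪ : ∀ {k} b (p q : Subset k) g → b ∨⋁[ p ∪ q ] g ≈ (b ∨⋁[ p ] g) ∨ (b ∨⋁[ q ] g)
  ∨⋁-∪ b []            []            g = sym (∨-idem b)
  ∨⋁-∪ b (inside ∷ p)  (inside ∷ q)  g =
    trans (∨-congˡ (∨⋁-∪ b p q (g ∘ suc))) (sym (trans (interchange _ _ _ _) (∨-congʳ (∨-idem _))))
  ∨⋁-∪ b (inside ∷ p)  (outside ∷ q) g =
    trans (∨-congˡ (∨⋁-∪ b p q (g ∘ suc))) (sym (∨-assoc _ _ _))
  ∨⋁-∪ b (outside ∷ p) (inside ∷ q)  g =
    trans (∨-congˡ (∨⋁-∪ b p q (g ∘ suc))) (x∙yz≈y∙xz _ _ _)
  ∨⋁-∪ b (outside ∷ p) (outside ∷ q) g = ∨⋁-∪ b p q (g ∘ suc)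

module _ {a b ℓ₁ ℓ₂ : Level} {L : Lattice a ℓ₁} {M : Lattice b ℓ₂} where
  private
    module L = Lattice L
    module M = Lattice M

  ∨⋁-homo : (h : L.Carrier → M.Carrier) → (∀ x y → h (x L.∨ y) M.≈ h x M.∨ h y) →
            ∀ {k} b (p : Subset k) g → h (_∨⋁[_]_ L b p g) M.≈ _∨⋁[_]_ M (h b) p (h ∘ g)
  ∨⋁-homo h h-∨ b []            g = M.refl
  ∨⋁-homo h h-∨ b (inside ∷ p)  g = M.trans (h-∨ _ _) (M.∨-congˡ (∨⋁-homo h h-∨ b p (g ∘ suc)))
  ∨⋁-homo h h-∨ b (outside ∷ p) g = ∨⋁-homo h h-∨ b p (g ∘ suc)

⊥∨⋁⁅⁆ : ∀ {k} (p : Subset k) → _∨⋁[_]_ (Subsets k) ⊥ p ⁅_⁆ ≡ p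
⊥∨⋁⁅⁆ []      = refl
⊥∨⋁⁅⁆ (x ∷ p) = ≡.trans (⊥∨⋁⁅⁆-∷ x) (cong (x ∷_) (⊥∨⋁⁅⁆ p))
  where
    outside∷-∨⋁ : _∨⋁[_]_ (Subsets (suc _)) ⊥ p (⁅_⁆ ∘ suc) ≡ outside ∷ _∨⋁[_]_ (Subsets _) ⊥ p ⁅_⁆
    outside∷-∨⋁ =
      ≡.sym (∨⋁-homo {L = Subsets _} {M = Subsets (suc _)} (outside ∷_) (λ _ _ → refl) ⊥ p ⁅_⁆)

    ⊥∨⋁⁅⁆-∷ : ∀ x → _∨⋁[_]_ (Subsets (suc _)) ⊥ (x ∷ p) ⁅_⁆ ≡ x ∷ _∨⋁[_]_ (Subsets _) ⊥ p ⁅_⁆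
    ⊥∨⋁⁅⁆-∷ inside  =
      ≡.trans (cong ((inside ∷ ⊥) ∪_) outside∷-∨⋁) (cong (inside ∷_) (∪-identityˡ _))
    ⊥∨⋁⁅⁆-∷ outside = outside∷-∨⋁

module FreeLattice (X : Set) where
  infixr 6 _∨ᶠ_
  infixr 7 _∧ᶠ_
  data Term : Set where
    gen  : X → Term
    _∨ᶠ_ : Term → Term → Term
    _∧ᶠ_ : Term → Term → Term

  infix 4 _≈ᶠ_
  data _≈ᶠ_ : Term → Term → Set where
    ≈-refl      : ∀ {x} → x ≈ᶠ x
    ≈-sym       : ∀ {x y} → x ≈ᶠ y → y ≈ᶠ x
    ≈-trans     : ∀ {x y z} → x ≈ᶠ y → y ≈ᶠ z → x ≈ᶠ z
    ∨-cong      : ∀ {x y u v} → x ≈ᶠ y → u ≈ᶠ v → x ∨ᶠ u ≈ᶠ y ∨ᶠ v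
    ∧-cong      : ∀ {x y u v} → x ≈ᶠ y → u ≈ᶠ v → x ∧ᶠ u ≈ᶠ y ∧ᶠ v
    ∨-comm      : ∀ x y → x ∨ᶠ y ≈ᶠ y ∨ᶠ x
    ∨-assoc     : ∀ x y z → (x ∨ᶠ y) ∨ᶠ z ≈ᶠ x ∨ᶠ (y ∨ᶠ z)
    ∧-comm      : ∀ x y → x ∧ᶠ y ≈ᶠ y ∧ᶠ x
    ∧-assoc     : ∀ x y z → (x ∧ᶠ y) ∧ᶠ z ≈ᶠ x ∧ᶠ (y ∧ᶠ z)
    ∨-absorbs-∧ : ∀ x y → x ∨ᶠ (x ∧ᶠ y) ≈ᶠ x
    ∧-absorbs-∨ : ∀ x y → x ∧ᶠ (x ∨ᶠ y) ≈ᶠ x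

  lattice : Lattice 0ℓ 0ℓ
  lattice = record
    { Carrier   = Term
    ; _≈_       = _≈ᶠ_
    ; _∨_       = _∨ᶠ_
    ; _∧_       = _∧ᶠ_
    ; isLattice = record
      { isEquivalence = record { refl = ≈-refl ; sym = ≈-sym ; trans = ≈-trans }
      ; ∨-comm        = ∨-comm
      ; ∨-assoc       = ∨-assoc
      ; ∨-cong        = ∨-cong
      ; ∧-comm        = ∧-comm
      ; ∧-assoc       = ∧-assoc
      ; ∧-cong        = ∧-cong
      ; absorptive    = ∨-absorbs-∧ , ∧-absorbs-∨
      }
    }

  module _ {c ℓ : Level} (M : Lattice c ℓ) (f : X → Lattice.Carrier M) where
    private module M = Lattice M

    eval : Term → M.Carrier
    eval (gen x)  = f x
    eval (x ∨ᶠ y) = eval x M.∨ eval y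
    eval (x ∧ᶠ y) = eval x M.∧ eval y

    eval-cong : ∀ {x y} → x ≈ᶠ y → eval x M.≈ eval y
    eval-cong ≈-refl                = M.refl
    eval-cong (≈-sym x≈y)           = M.sym (eval-cong x≈y)
    eval-cong (≈-trans x≈y y≈z)     = M.trans (eval-cong x≈y) (eval-cong y≈z)
    eval-cong (∨-cong x≈y u≈v)      = M.∨-cong (eval-cong x≈y) (eval-cong u≈v)
    eval-cong (∧-cong x≈y u≈v)      = M.∧-cong (eval-cong x≈y) (eval-cong u≈v)
    eval-cong (∨-comm x y)          = M.∨-comm (eval x) (eval y)
    eval-cong (∨-assoc x y z)       = M.∨-assoc (eval x) (eval y) (eval z)
    eval-cong (∧-comm x y)          = M.∧-comm (eval x) (eval y)
    eval-cong (∧-assoc x y z)       = M.∧-assoc (eval x) (eval y) (eval z)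
    eval-cong (∨-absorbs-∧ x y)     = M.∨-absorbs-∧ (eval x) (eval y)
    eval-cong (∧-absorbs-∨ x y)     = M.∧-absorbs-∨ (eval x) (eval y)

  isFreeLatticeOn-gen : IsFreeLatticeOn lattice gen
  isFreeLatticeOn-gen M f = eval M f , isHomomorphism , (λ _ → M.refl) , unique
    where
      module M = Lattice M
      open LatticeMorphisms (Lattice.rawLattice lattice) (Lattice.rawLattice M)

      isHomomorphism : IsLatticeHomomorphism (eval M f)
      isHomomorphism = record
        { isRelHomomorphism = record { cong = eval-cong M f }
        ; ∧-homo            = λ _ _ → M.refl
        ; ∨-homo            = λ _ _ → M.refl
        }

      unique : ∀ h → IsLatticeHomomorphism h → (∀ x → h (gen x) M.≈ f x) → ∀ y → h y M.≈ eval M f y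
      unique h hom h-gen = h≈eval
        where
          open IsLatticeHomomorphism hom using (∨-homo; ∧-homo)

          h≈eval : ∀ y → h y M.≈ eval M f y
          h≈eval (gen x)  = h-gen x
          h≈eval (x ∨ᶠ y) = M.trans (∨-homo x y) (M.∨-cong (h≈eval x) (h≈eval y))
          h≈eval (x ∧ᶠ y) = M.trans (∧-homo x y) (M.∧-cong (h≈eval x) (h≈eval y))

  isFreeLattice : IsFreeLattice lattice
  isFreeLattice = X , gen , isFreeLatticeOn-gen

module _ (k : ℕ) where
  open FreeLattice (Fin (suc k))

  -- g₀ stands in for the empty join, which a free lattice lacks.
  embed : Subset k → Term
  embed p = _∨⋁[_]_ lattice (gen zero) p (gen ∘ suc)

  embed-∪ : ∀ p q → embed (p ∪ q) ≈ᶠ embed p ∨ᶠ embed q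
  embed-∪ p q = ∨⋁-∪ lattice (gen zero) p q (gen ∘ suc)

  retract-gen : Fin (suc k) → Subset k
  retract-gen zero    = ⊥
  retract-gen (suc i) = ⁅ i ⁆

  retract : Term → Subset k
  retract = eval (Subsets k) retract-gen

  retract∘embed : ∀ p → retract (embed p) ≡ p
  retract∘embed p =
    ≡.trans (∨⋁-homo {L = lattice} {M = Subsets k} retract (λ _ _ → refl) (gen zero) p (gen ∘ suc))
            (⊥∨⋁⁅⁆ p)

  embed-≤⇔ : ∀ {p q} → _≤L_ (Subsets k) p q ⇔ _≤L_ lattice (embed p) (embed q)
  embed-≤⇔ {p} {q} = mk⇔
    (λ p∪q≡q → ≈-trans (≈-sym (embed-∪ p q)) (Lattice.reflexive lattice (cong embed p∪q≡q)))
    reflects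
    where
      open ≡.≡-Reasoning

      reflects : embed p ∨ᶠ embed q ≈ᶠ embed q → p ∪ q ≡ q
      reflects ep≤eq = begin
        p ∪ q                        ≡⟨ cong₂ _∪_ (retract∘embed p) (retract∘embed q) ⟨
        retract (embed p ∨ᶠ embed q) ≡⟨ eval-cong (Subsets k) retract-gen ep≤eq ⟩
        retract (embed q)            ≡⟨ retract∘embed q ⟩
        q                            ∎

  holds-in-free : ∀ ψ → Holds (Subsets k) ψ → Holds lattice ψ
  holds-in-free = holds-along-join-embedding (Subsets k) lattice embed embed-∪ embed-≤⇔

corollary3p6 : {c ℓ : Level} (ψ : JSentence) →
    Σ (Lattice c ℓ) (λ L → Holds L ψ) →
    Σ (DistributiveLattice 0ℓ 0ℓ) (λ D → Finite (DistributiveLattice.lattice D) × Holds (DistributiveLattice.lattice D) ψ)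
    × Σ (Lattice 0ℓ 0ℓ) (λ F → IsFreeLattice F × Holds F ψ)
corollary3p6 ψ@(mkSentence m ls ns) (L , holds) =
    (∪-∩-distributiveLattice k , Subsets-finite k , holds-in-2ᵏ)
  , (FreeLattice.lattice (Fin (suc k)) , FreeLattice.isFreeLattice (Fin (suc k))
     , holds-in-free k ψ holds-in-2ᵏ)
  where
    k : ℕ
    k = length ns

    holds-in-2ᵏ : Holds (Subsets k) ψ
    holds-in-2ᵏ = holds-in-Subsets ls
      (All.map (λ {n} → holds-in-𝔹 L ls n) (restrict-to-each-negation L ls ns holds))
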